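{- Let $\gamma>1$ and let $\mathcal{O}$ be an oracle which, given linearly independent vectors $\mathbf{B}\in\mathbb{Q}^{m\times n}$, returns an elementary vector $\mathbf{v}\in\mathcal{L}(\mathbf{B})$ with $0<\|\mathbf{v}\|\le\gamma\lambda_1(\mathcal{L}(\mathbf{B}))$. Consider the recursive procedure $\mathrm{CVP}(\mathbf{B},\mathbf{t})$ on input a basis $\mathbf{B}\in\mathbb{Q}^{m\times n}$ and a target $\mathbf{t}\in\mathbb{Q}^m$: (i) If $n=1$, with $\mathbf{b}_1$ the only column of $\mathbf{B}$, return $a\mathbf{b}_1$ for an $a\in\mathbb{Z}$ minimizing $\|a\mathbf{b}_1-\mathbf{t}\|$. (ii) Otherwise: let $\mathbf{z}_1\in\mathcal{L}(\mathbf{B})$ be the output of a subroutine which, whenever $\mathrm{dist}(\mathbf{t},\mathcal{L}(\mathbf{B}))\le\lambda_1(\mathbf{B})/(2\gamma)$, returns a lattice vector $\mathbf{z}_1$ with $\|\mathbf{z}_1-\mathbf{t}\|=\mathrm{dist}(\mathbf{t},\mathcal{L}(\mathbf{B}))$ (and otherwise returns some lattice vector). Let $\mathbf{v}\gets\mathcal{O}(\mathbf{B})$. Compute vectors $\mathbf{b}_2,\ldots,\mathbf{b}_n$ such that $\mathcal{L}(\mathbf{v},\mathbf{b}_2,\ldots,\mathbf{b}_n)=\mathcal{L}(\mathbf{B})$. Let $\mathbf{B}'_{\perp\mathbf{v}}$ be the basis $\{(\mathbf{b}_2)_{\perp\mathbf{v}},\ldots,(\mathbf{b}_n)_{\perp\mathbf{v}}\}$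 and $\mathbf{t}_{\perp\mathbf{v}}$ the projection of $\mathbf{t}$, and recursively compute $\mathbf{z}'_2\gets\mathrm{CVP}(\mathbf{B}'_{\perp\mathbf{v}},\mathbf{t}_{\perp\mathbf{v}})$. Write $\mathbf{z}'_2=\sum_{i=2}^n a_i(\mathbf{b}_i)_{\perp\mathbf{v}}$ with $a_i\in\mathbb{Z}$, choose $a_1\in\mathbb{Z}$ such that $\mathbf{z}_2=a_1\mathbf{v}+\sum_{i=2}^n a_i\mathbf{b}_i$ is closest to $\mathbf{t}$, and return whichever of $\mathbf{z}_1,\mathbf{z}_2$ is closer to $\mathbf{t}$. Then the procedure outputs a vector $\mathbf{z}\in\mathcal{L}(\mathbf{B})$ with $\|\mathbf{z}-\mathbf{t}\|\le\gamma^2\sqrt{n}\,\mathrm{dist}(\mathbf{t},\mathcal{L}(\mathbf{B}))$.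
   Context: A lattice basis is a set of linearly independent vectors $\mathbf{b}_1,\ldots,\mathbf{b}_n\in\mathbb{Q}^m$ (columns of $\mathbf{B}$), and $\mathcal{L}(\mathbf{B})=\{\mathbf{B}x:x\in\mathbb{Z}^n\}$. Norms are Euclidean. $\lambda_1(\mathbf{B})$ is the length of a shortest nonzero lattice vector; $\mathrm{dist}(\mathbf{t},\mathcal{L}(\mathbf{B}))$ is the distance from $\mathbf{t}$ to the nearest lattice point. A lattice vector is elementary if it is not a nontrivial integer multiple of another lattice vector. For vectors $\mathbf{u},\mathbf{v}$ with $\mathbf{v}\ne0$, $\mathbf{u}|_{\mathbf{v}}=\frac{\langle\mathbf{u},\mathbf{v}\rangle}{\langle\mathbf{v},\mathbf{v}\rangle}\mathbf{v}$ and $\mathbf{u}_{\perp\mathbf{v}}=\mathbf{u}-\mathbf{u}|_{\mathbf{v}}$.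
   Formalization: The parameter γ only takes values γ > 1 whose square γ² is rational. -}

module Defs where

open import Data.Nat using (ℕ; zero; suc)
open import Data.Integer using (ℤ; +_; -[1+_])
open import Data.Rational using (ℚ; 0ℚ; _+_; _*_; _-_; _≤_; _/_; 1/_; ≢-nonZero)
open import Data.Rational.Properties using (_≟_)
open import Data.Vec using (Vec; []; _∷_; zipWith; map; replicate; foldr)
open import Data.Product using (Σ; ∃; _×_; _,_)
open import Data.Sum using (_⊎_)
open import Relation.Nullary using (¬_; yes; no)
open import Relation.Binary.PropositionalEquality using (_≡_; _≢_)
open import Function.Bundles using (_⇔_)

Vecℚ : ℕ → Set
Vecℚ m = Vec ℚ m

-- A basis B ∈ ℚ^{m×n}, given as the list of its n columns b₁,…,bₙ ∈ ℚ^m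
Basis : ℕ → ℕ → Set
Basis m n = Vec (Vecℚ m) n

ιℤ : ℤ → ℚ
ιℤ k = k / 1

0v : ∀ {m} → Vecℚ m
0v = replicate _ 0ℚ

_+v_ : ∀ {m} → Vecℚ m → Vecℚ m → Vecℚ m
_+v_ = zipWith _+_

_-v_ : ∀ {m} → Vecℚ m → Vecℚ m → Vecℚ m
_-v_ = zipWith _-_

_·v_ : ∀ {m} → ℚ → Vecℚ m → Vecℚ m
c ·v u = map (c *_) u

⟨_,_⟩ : ∀ {m} → Vecℚ m → Vecℚ m → ℚ
⟨ u , w ⟩ = foldr _ _+_ 0ℚ (zipWith _*_ u w)

‖_‖² : ∀ {m} → Vecℚ m → ℚ
‖ u ‖² = ⟨ u , u ⟩

combℚ : ∀ {m n} → Vec ℚ n → Basis m n → Vecℚ m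
combℚ [] [] = 0v
combℚ (x ∷ xs) (b ∷ bs) = (x ·v b) +v combℚ xs bs

comb : ∀ {m n} → Vec ℤ n → Basis m n → Vecℚ m
comb xs bs = combℚ (map ιℤ xs) bs

LinIndep : ∀ {m n} → Basis m n → Set
LinIndep {n = n} B = (x : Vec ℚ n) → combℚ x B ≡ 0v → x ≡ replicate n 0ℚ

InL : ∀ {m n} → Basis m n → Vecℚ m → Set
InL {n = n} B w = Σ (Vec ℤ n) λ x → w ≡ comb x B

SameLattice : ∀ {m n k} → Basis m n → Basis m k → Set
SameLattice {m} B C = (w : Vecℚ m) → InL B w ⇔ InL C w

Elementary : ∀ {m n} → Basis m n → Vecℚ m → Set
Elementary B v =
  InL B v × ((w : _) → InL B w → (k : ℤ) → v ≡ (ιℤ k ·v w) →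
               (k ≡ + 1) ⊎ (k ≡ -[1+ 0 ]))

-- projection orthogonal to v:  u_{⊥v} = u - (⟨u,v⟩/⟨v,v⟩) v   (u itself if v = 0)
proj⊥ : ∀ {m} → Vecℚ m → Vecℚ m → Vecℚ m
proj⊥ v u with ⟨ v , v ⟩ ≟ 0ℚ
... | yes _ = u
... | no vv≢0 = u -v ((⟨ u , v ⟩ * (1/_ ⟨ v , v ⟩ {{≢-nonZero vv≢0}})) ·v v)

-- An oracle / subroutine is a (deterministic) map on bases of any shape.
Oracle : Set
Oracle = ∀ {m n} → Basis m n → Vecℚ m

Subroutine : Set
Subroutine = ∀ {m n} → Basis m n → Vecℚ m → Vecℚ m

-- g plays the role of γ² (γ > 1 ⇔ g > 1).
-- Oracle specification: for linearly independent B (n ≥ 1), O(B) is an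
-- elementary lattice vector with 0 < ‖v‖ ≤ γ λ₁(L(B)), i.e.
-- ‖v‖² ≤ γ² ‖w‖² for every nonzero w ∈ L(B).
OracleSpec : ℚ → Oracle → Set
OracleSpec g O = ∀ {m n} (B : Basis m (suc n)) → LinIndep B →
  Elementary B (O B) × (O B ≢ 0v) ×
  ((w : Vecℚ m) → InL B w → w ≢ 0v → ‖ O B ‖² ≤ g * ‖ w ‖²)

-- "dist(t, L(B)) ≤ λ₁(B)/(2γ)": some lattice point w (a closest one) satisfies
-- 2γ‖w - t‖ ≤ ‖u‖ for all nonzero u ∈ L(B).
CloseTarget : ℚ → ∀ {m n} → Basis m n → Vecℚ m → Set
CloseTarget g {m} B t = Σ (Vecℚ m) λ w → InL B w ×
  ((u : Vecℚ m) → InL B u → u ≢ 0v → ((+ 4 / 1) * g) * ‖ w -v t ‖² ≤ ‖ u ‖²)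

Closest : ∀ {m n} → Basis m n → Vecℚ m → Vecℚ m → Set
Closest {m} B t z = InL B z × ((w : Vecℚ m) → InL B w → ‖ z -v t ‖² ≤ ‖ w -v t ‖²)

SubroutineSpec : ℚ → Subroutine → Set
SubroutineSpec g S = ∀ {m n} (B : Basis m (suc n)) (t : Vecℚ m) → LinIndep B →
  InL B (S B t) × (CloseTarget g B t → Closest B t (S B t))

-- CVP O S B t z : z is a possible output of the procedure CVP(B, t)
-- (all free choices — the completion b₂,…,bₙ, tie-breaking in the minimizations
-- and in the final comparison — range over all admissible choices).
data CVP (O : Oracle) (S : Subroutine) : ∀ {m n} → Basis m (suc n) → Vecℚ m → Vecℚ m → Set where
  base : ∀ {m} (b₁ t : Vecℚ m) (a : ℤ) →
    ((a' : ℤ) → ‖ (ιℤ a ·v b₁) -v t ‖² ≤ ‖ (ιℤ a' ·v b₁) -v t ‖²) →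
    CVP O S (b₁ ∷ []) t (ιℤ a ·v b₁)
  step : ∀ {m n} (B : Basis m (suc (suc n))) (t : Vecℚ m)
    (bs : Basis m (suc n)) → SameLattice (O B ∷ bs) B →
    (z₂' : Vecℚ m) → CVP O S (map (proj⊥ (O B)) bs) (proj⊥ (O B) t) z₂' →
    (as : Vec ℤ (suc n)) → z₂' ≡ comb as (map (proj⊥ (O B)) bs) →
    (a₁ : ℤ) →
    ((a' : ℤ) → ‖ ((ιℤ a₁ ·v O B) +v comb as bs) -v t ‖²
                 ≤ ‖ ((ιℤ a' ·v O B) +v comb as bs) -v t ‖²) →
    (z : Vecℚ m) →
    (  (z ≡ S B t × ‖ S B t -v t ‖² ≤ ‖ ((ιℤ a₁ ·v O B) +v comb as bs) -v t ‖²)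
     ⊎ (z ≡ (ιℤ a₁ ·v O B) +v comb as bs
        × ‖ ((ιℤ a₁ ·v O B) +v comb as bs) -v t ‖² ≤ ‖ S B t -v t ‖²)) →
    CVP O S B t z

module Submission where

-- Write g = γ².  In rank one the
-- procedure rounds the coefficient of b₁ and is exact.  In a recursive step with
-- v = O(B) and d = ‖w - t‖ we distinguish two cases.
--   * Far target, ‖v‖² > 4g²d²: every nonzero lattice vector u has ‖u‖² ≥ ‖v‖²/g > 4g d²,
--     so t is within λ₁/(2γ) of L(B), and the subroutine's answer z₁ is a closest vector.
--   * Near target, ‖v‖² ≤ 4g²d²: by Pythagoras the error e = z₂ - t of the lifted
--     recursive answer satisfies ‖e‖² = ‖e_⊥v‖² + ⟨e,v⟩²/‖v‖².  The first term is the
--     recursive error, at most g²(n-1)d² because projection does not increase distances;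
--     the second is at most ‖v‖²/4 ≤ g²d² because a₁ is the best integer coefficient.
-- The recursion needs the projected basis to be independent; this follows from the
-- dimension bound "more vectors than coordinates are dependent" (Gaussian elimination).

open import Defs
open import Data.Nat using (ℕ; suc; zero; s≤s)
import Data.Nat as N
import Data.Nat.Properties as NP
import Data.Integer as Z
import Data.Integer.Properties as ZP
open import Data.Integer using (ℤ; +_; -[1+_])
open import Data.Rational using (ℚ; 0ℚ; 1ℚ; _<_; _≤_; _*_; _/_; _+_; _-_; -_; 1/_; Positive; positive; nonNegative; ≢-nonZero)
open import Data.Rational.Properties
import Data.Rational.Unnormalised as U
import Data.Rational.Unnormalised.Properties as UP
open import Data.Rational.Solver using (module +-*-Solver)
open +-*-Solver
open import Data.Fin using (Fin; zero; suc)
open import Data.Vec using (Vec; []; _∷_; map; replicate; head; tail; lookup; insertAt; removeAt)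
import Data.Vec.Properties as VP
open import Data.Vec.Relation.Unary.All using (All; []; _∷_)
import Data.Vec.Relation.Unary.All as All
open import Relation.Binary.PropositionalEquality
open import Data.Product using (Σ; _×_; _,_; proj₁; proj₂)
open import Data.Sum using (_⊎_; inj₁; inj₂)
open import Data.Empty using (⊥-elim)
open import Relation.Nullary using (¬_; yes; no)
open import Function.Bundles using (Equivalence)

0≤q-p : ∀ {p q} → p ≤ q → 0ℚ ≤ q - p
0≤q-p {p} {q} p≤q = subst (_≤ q - p) (+-inverseʳ p) (+-monoˡ-≤ (- p) p≤q)

0≤q-p⇒p≤q : ∀ {p q} → 0ℚ ≤ q - p → p ≤ q
0≤q-p⇒p≤q {p} {q} h = subst₂ _≤_ (+-identityˡ p)
  (solve 2 (λ p q → (q :- p) :+ p := q) refl p q) (+-monoˡ-≤ p h)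

0≤p*q : ∀ {p q} → 0ℚ ≤ p → 0ℚ ≤ q → 0ℚ ≤ p * q
0≤p*q {p} {q} 0≤p 0≤q = nonNegative⁻¹ (p * q)
  {{nonNeg*nonNeg⇒nonNeg p {{nonNegative 0≤p}} q {{nonNegative 0≤q}}}}

0≤p+q : ∀ {p q} → 0ℚ ≤ p → 0ℚ ≤ q → 0ℚ ≤ p + q
0≤p+q = +-mono-≤

0≤p*p : ∀ p → 0ℚ ≤ p * p
0≤p*p p with ≤-total 0ℚ p
... | inj₁ 0≤p = 0≤p*q 0≤p 0≤p
... | inj₂ p≤0 = subst (0ℚ ≤_) (solve 1 (λ p → (:- p) :* (:- p) := p :* p) refl p)
                   (0≤p*q 0≤-p 0≤-p)
  where
  0≤-p : 0ℚ ≤ - p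
  0≤-p = subst (0ℚ ≤_) (+-identityˡ (- p)) (0≤q-p p≤0)

p*p≡0⇒p≡0 : ∀ p → p * p ≡ 0ℚ → p ≡ 0ℚ
p*p≡0⇒p≡0 p pp≡0 with p ≟ 0ℚ
... | yes p≡0 = p≡0
... | no p≢0 = ⊥-elim (1≢0 (begin
    1ℚ                  ≡⟨ sym (cong₂ _*_ (*-inverseʳ p) (*-inverseʳ p)) ⟩
    (p * q) * (p * q)   ≡⟨ solve 2 (λ p q → (p :* q) :* (p :* q) := (p :* p) :* (q :* q)) refl p q ⟩
    (p * p) * (q * q)   ≡⟨ cong (_* (q * q)) pp≡0 ⟩
    0ℚ * (q * q)        ≡⟨ *-zeroˡ (q * q) ⟩
    0ℚ                  ∎))
  where
  instance _ = ≢-nonZero p≢0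
  q = 1/ p
  open ≡-Reasoning

p+q≡0⇒p≡0 : ∀ {p q} → 0ℚ ≤ p → 0ℚ ≤ q → p + q ≡ 0ℚ → p ≡ 0ℚ
p+q≡0⇒p≡0 {p} {q} 0≤p 0≤q p+q≡0 =
  ≤-antisym (subst₂ _≤_ (+-identityʳ p) p+q≡0 (+-monoʳ-≤ p 0≤q)) 0≤p

1≤p*q : ∀ {p q} → 1ℚ ≤ p → 1ℚ ≤ q → 1ℚ ≤ p * q
1≤p*q {p} {q} 1≤p 1≤q = 0≤q-p⇒p≤q (subst (0ℚ ≤_)
  (solve 2 (λ p q → (p :- con 1ℚ) :* (q :- con 1ℚ) :+ (p :- con 1ℚ) :+ (q :- con 1ℚ)
                    := p :* q :- con 1ℚ) refl p q)
  (0≤p+q (0≤p+q (0≤p*q (0≤q-p 1≤p) (0≤q-p 1≤q)) (0≤q-p 1≤p)) (0≤q-p 1≤q)))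

p≤k*p : ∀ {k p} → 1ℚ ≤ k → 0ℚ ≤ p → p ≤ k * p
p≤k*p {k} {p} 1≤k 0≤p =
  subst (_≤ k * p) (*-identityˡ p) (*-monoʳ-≤-nonNeg p {{nonNegative 0≤p}} 1≤k)

ιℤ-+ : ∀ a b → ιℤ (a Z.+ b) ≡ ιℤ a + ιℤ b
ιℤ-+ a b = toℚᵘ-injective (UP.≃-trans (toℚᵘ-fromℚᵘ (U.mkℚᵘ (a Z.+ b) 0))
  (UP.≃-sym (UP.≃-trans (toℚᵘ-homo-+ (ιℤ a) (ιℤ b))
    (UP.≃-trans (UP.+-cong (toℚᵘ-fromℚᵘ (U.mkℚᵘ a 0)) (toℚᵘ-fromℚᵘ (U.mkℚᵘ b 0)))
      sum-of-integers))))
  where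
  sum-of-integers : U.mkℚᵘ a 0 U.+ U.mkℚᵘ b 0 U.≃ U.mkℚᵘ (a Z.+ b) 0
  sum-of-integers = U.*≡* (trans (ZP.*-identityʳ _)
    (trans (cong₂ Z._+_ (ZP.*-identityʳ a) (ZP.*-identityʳ b)) (sym (ZP.*-identityʳ _))))

ιℤ-suc : ∀ k → ιℤ (+ suc k) ≡ 1ℚ + ιℤ (+ k)
ιℤ-suc k = ιℤ-+ (+ 1) (+ k)

0≤ιℤ : ∀ k → 0ℚ ≤ ιℤ (+ k)
0≤ιℤ zero = ≤-refl
0≤ιℤ (suc k) = subst (0ℚ ≤_) (sym (ιℤ-suc k)) (0≤p+q (<⇒≤ (positive⁻¹ 1ℚ)) (0≤ιℤ k))

1≤ιℤ : ∀ k → 1ℚ ≤ ιℤ (+ suc k)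
1≤ιℤ k = subst₂ _≤_ (+-identityʳ 1ℚ) (sym (ιℤ-suc k)) (+-monoʳ-≤ 1ℚ (0≤ιℤ k))

+v-identityˡ : ∀ {m} (u : Vecℚ m) → 0v +v u ≡ u
+v-identityˡ [] = refl
+v-identityˡ (x ∷ u) = cong₂ _∷_ (+-identityˡ x) (+v-identityˡ u)

+v-identityʳ : ∀ {m} (u : Vecℚ m) → u +v 0v ≡ u
+v-identityʳ [] = refl
+v-identityʳ (x ∷ u) = cong₂ _∷_ (+-identityʳ x) (+v-identityʳ u)

·v-zeroʳ : ∀ {m} (c : ℚ) → c ·v (0v {m}) ≡ 0v
·v-zeroʳ {zero} c = refl
·v-zeroʳ {suc m} c = cong₂ _∷_ (*-zeroʳ c) (·v-zeroʳ c)

·v-zeroˡ : ∀ {m} (u : Vecℚ m) → 0ℚ ·v u ≡ 0v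
·v-zeroˡ [] = refl
·v-zeroˡ (x ∷ u) = cong₂ _∷_ (*-zeroˡ x) (·v-zeroˡ u)

·v-identityˡ : ∀ {m} (u : Vecℚ m) → 1ℚ ·v u ≡ u
·v-identityˡ [] = refl
·v-identityˡ (x ∷ u) = cong₂ _∷_ (*-identityˡ x) (·v-identityˡ u)

·v-assoc : ∀ {m} (a b : ℚ) (u : Vecℚ m) → (a * b) ·v u ≡ a ·v (b ·v u)
·v-assoc a b [] = refl
·v-assoc a b (x ∷ u) = cong₂ _∷_ (*-assoc a b x) (·v-assoc a b u)

+v-swapˡ : ∀ {m} (u w y : Vecℚ m) → u +v (w +v y) ≡ w +v (u +v y)
+v-swapˡ [] [] [] = refl
+v-swapˡ (a ∷ u) (b ∷ w) (c ∷ y) =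
  cong₂ _∷_ (solve 3 (λ a b c → a :+ (b :+ c) := b :+ (a :+ c)) refl a b c) (+v-swapˡ u w y)

-v-·v-self : ∀ {m} (u : Vecℚ m) → u -v (1ℚ ·v u) ≡ 0v
-v-·v-self [] = refl
-v-·v-self (x ∷ u) = cong₂ _∷_ (solve 1 (λ x → x :- con 1ℚ :* x := con 0ℚ) refl x) (-v-·v-self u)

-v-·v-zero : ∀ {m} (u : Vecℚ m) → 0v -v (0ℚ ·v u) ≡ 0v
-v-·v-zero [] = refl
-v-·v-zero (x ∷ u) = cong₂ _∷_ (solve 1 (λ x → con 0ℚ :- con 0ℚ :* x := con 0ℚ) refl x) (-v-·v-zero u)

·v-+v-interchange : ∀ {m} (a b : ℚ) (u x y : Vecℚ m) →
  ((a + b) ·v u) +v (x +v y) ≡ ((a ·v u) +v x) +v ((b ·v u) +v y)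
·v-+v-interchange a b [] [] [] = refl
·v-+v-interchange a b (c ∷ u) (p ∷ x) (q ∷ y) = cong₂ _∷_
  (solve 5 (λ a b c p q → (a :+ b) :* c :+ (p :+ q) := (a :* c :+ p) :+ (b :* c :+ q)) refl a b c p q)
  (·v-+v-interchange a b u x y)

·v-distrib-step : ∀ {m} (c a : ℚ) (u x : Vecℚ m) → ((c * a) ·v u) +v (c ·v x) ≡ c ·v ((a ·v u) +v x)
·v-distrib-step c a [] [] = refl
·v-distrib-step c a (y ∷ u) (p ∷ x) = cong₂ _∷_
  (solve 4 (λ c a y p → (c :* a) :* y :+ c :* p := c :* (a :* y :+ p)) refl c a y p)
  (·v-distrib-step c a u x)

-- The map u ↦ u - φ(u)·v is additive, subtractive and homogeneous whenever φ is.
-v-·v-+ : ∀ {m} (a b : ℚ) (u w v : Vecℚ m) → (u +v w) -v ((a + b) ·v v) ≡ (u -v (a ·v v)) +v (w -v (b ·v v))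
-v-·v-+ a b [] [] [] = refl
-v-·v-+ a b (x ∷ u) (y ∷ w) (z ∷ v) = cong₂ _∷_
  (solve 5 (λ a b x y z → (x :+ y) :- (a :+ b) :* z := (x :- a :* z) :+ (y :- b :* z)) refl a b x y z)
  (-v-·v-+ a b u w v)

-v-·v-- : ∀ {m} (a b : ℚ) (u w v : Vecℚ m) → (u -v w) -v ((a - b) ·v v) ≡ (u -v (a ·v v)) -v (w -v (b ·v v))
-v-·v-- a b [] [] [] = refl
-v-·v-- a b (x ∷ u) (y ∷ w) (z ∷ v) = cong₂ _∷_
  (solve 5 (λ a b x y z → (x :- y) :- (a :- b) :* z := (x :- a :* z) :- (y :- b :* z)) refl a b x y z)
  (-v-·v-- a b u w v)

-v-·v-· : ∀ {m} (c a : ℚ) (u v : Vecℚ m) → (c ·v u) -v ((c * a) ·v v) ≡ c ·v (u -v (a ·v v))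
-v-·v-· c a [] [] = refl
-v-·v-· c a (x ∷ u) (z ∷ v) = cong₂ _∷_
  (solve 4 (λ c a x z → c :* x :- (c :* a) :* z := c :* (x :- a :* z)) refl c a x z)
  (-v-·v-· c a u v)

neg-·v-+v : ∀ {m} (β : ℚ) (w x : Vecℚ m) → ((- β) ·v w) +v x ≡ x -v (β ·v w)
neg-·v-+v β [] [] = refl
neg-·v-+v β (u ∷ w) (y ∷ x) = cong₂ _∷_
  (solve 3 (λ β u y → (:- β) :* u :+ y := y :- β :* u) refl β u y) (neg-·v-+v β w x)

solve-for : ∀ {m} (c c⁻¹ : ℚ) (w y : Vecℚ m) → (c ·v w) +v y ≡ 0v → c * c⁻¹ ≡ 1ℚ → w ≡ (- c⁻¹) ·v y
solve-for c c⁻¹ [] [] _ _ = refl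
solve-for c c⁻¹ (u ∷ w) (x ∷ y) cw+y≡0 cc⁻¹≡1 =
  cong₂ _∷_ coordinate (solve-for c c⁻¹ w y (cong tail cw+y≡0) cc⁻¹≡1)
  where
  open ≡-Reasoning
  coordinate : u ≡ (- c⁻¹) * x
  coordinate = sym (begin
    (- c⁻¹) * x                   ≡⟨ solve 2 (λ i x → (:- i) :* x := (:- i) :* x :+ i :* con 0ℚ) refl c⁻¹ x ⟩
    (- c⁻¹) * x + c⁻¹ * 0ℚ        ≡⟨ cong (λ k → (- c⁻¹) * x + c⁻¹ * k) (sym (cong head cw+y≡0)) ⟩
    (- c⁻¹) * x + c⁻¹ * (c * u + x) ≡⟨ solve 4 (λ i x c u → (:- i) :* x :+ i :* (c :* u :+ x) := u :* (c :* i)) refl c⁻¹ x c u ⟩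
    u * (c * c⁻¹)                 ≡⟨ cong (u *_) cc⁻¹≡1 ⟩
    u * 1ℚ                        ≡⟨ *-identityʳ u ⟩
    u                             ∎)

·v-+v-collect : ∀ {m} (a f b : ℚ) (c x w : Vecℚ m) →
  (a ·v (c -v (f ·v w))) +v (x -v (b ·v w)) ≡ ((a ·v c) +v x) -v ((a * f + b) ·v w)
·v-+v-collect a f b [] [] [] = refl
·v-+v-collect a f b (y ∷ c) (p ∷ x) (u ∷ w) = cong₂ _∷_
  (solve 6 (λ a f b y p u → a :* (y :- f :* u) :+ (p :- b :* u) := (a :* y :+ p) :- (a :* f :+ b) :* u) refl a f b y p u)
  (·v-+v-collect a f b c x w)

⟨⟩-comm : ∀ {m} (u w : Vecℚ m) → ⟨ u , w ⟩ ≡ ⟨ w , u ⟩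
⟨⟩-comm [] [] = refl
⟨⟩-comm (x ∷ u) (y ∷ w) = cong₂ _+_ (*-comm x y) (⟨⟩-comm u w)

⟨⟩-+ˡ : ∀ {m} (u w z : Vecℚ m) → ⟨ u +v w , z ⟩ ≡ ⟨ u , z ⟩ + ⟨ w , z ⟩
⟨⟩-+ˡ [] [] [] = refl
⟨⟩-+ˡ (x ∷ u) (y ∷ w) (c ∷ z) = trans (cong (_+_ ((x + y) * c)) (⟨⟩-+ˡ u w z))
  (solve 5 (λ x y c A B → (x :+ y) :* c :+ (A :+ B) := (x :* c :+ A) :+ (y :* c :+ B)) refl x y c ⟨ u , z ⟩ ⟨ w , z ⟩)

⟨⟩--ˡ : ∀ {m} (u w z : Vecℚ m) → ⟨ u -v w , z ⟩ ≡ ⟨ u , z ⟩ - ⟨ w , z ⟩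
⟨⟩--ˡ [] [] [] = refl
⟨⟩--ˡ (x ∷ u) (y ∷ w) (c ∷ z) = trans (cong (_+_ ((x - y) * c)) (⟨⟩--ˡ u w z))
  (solve 5 (λ x y c A B → (x :- y) :* c :+ (A :- B) := (x :* c :+ A) :- (y :* c :+ B)) refl x y c ⟨ u , z ⟩ ⟨ w , z ⟩)

⟨⟩-·ˡ : ∀ {m} (a : ℚ) (u z : Vecℚ m) → ⟨ a ·v u , z ⟩ ≡ a * ⟨ u , z ⟩
⟨⟩-·ˡ a [] [] = sym (*-zeroʳ a)
⟨⟩-·ˡ a (x ∷ u) (c ∷ z) = trans (cong (_+_ ((a * x) * c)) (⟨⟩-·ˡ a u z))
  (solve 4 (λ a x c A → (a :* x) :* c :+ a :* A := a :* (x :* c :+ A)) refl a x c ⟨ u , z ⟩)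

⟨⟩-0ˡ : ∀ {m} (z : Vecℚ m) → ⟨ 0v , z ⟩ ≡ 0ℚ
⟨⟩-0ˡ [] = refl
⟨⟩-0ˡ (c ∷ z) = trans (cong (_+_ (0ℚ * c)) (⟨⟩-0ˡ z)) (trans (+-identityʳ (0ℚ * c)) (*-zeroˡ c))

⟨⟩-0ʳ : ∀ {m} (z : Vecℚ m) → ⟨ z , 0v ⟩ ≡ 0ℚ
⟨⟩-0ʳ z = trans (⟨⟩-comm z 0v) (⟨⟩-0ˡ z)

‖‖²-nonNeg : ∀ {m} (u : Vecℚ m) → 0ℚ ≤ ‖ u ‖²
‖‖²-nonNeg [] = ≤-refl
‖‖²-nonNeg (x ∷ u) = 0≤p+q (0≤p*p x) (‖‖²-nonNeg u)

‖‖²≡0⇒≡0 : ∀ {m} (u : Vecℚ m) → ‖ u ‖² ≡ 0ℚ → u ≡ 0v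
‖‖²≡0⇒≡0 [] _ = refl
‖‖²≡0⇒≡0 (x ∷ u) ‖xu‖²≡0 = cong₂ _∷_
  (p*p≡0⇒p≡0 x (p+q≡0⇒p≡0 (0≤p*p x) (‖‖²-nonNeg u) ‖xu‖²≡0))
  (‖‖²≡0⇒≡0 u (p+q≡0⇒p≡0 (‖‖²-nonNeg u) (0≤p*p x) (trans (+-comm _ (x * x)) ‖xu‖²≡0)))

‖-·‖²-expand : ∀ {m} (c : ℚ) (u v : Vecℚ m) →
  ‖ u -v (c ·v v) ‖² ≡ ‖ u ‖² - (c * ⟨ u , v ⟩ + c * ⟨ u , v ⟩) + c * c * ⟨ v , v ⟩
‖-·‖²-expand c [] [] = solve 1 (λ c → con 0ℚ := con 0ℚ :- (c :* con 0ℚ :+ c :* con 0ℚ) :+ c :* c :* con 0ℚ) refl c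
‖-·‖²-expand c (x ∷ u) (y ∷ v) = trans (cong (_+_ ((x - c * y) * (x - c * y))) (‖-·‖²-expand c u v))
  (solve 6 (λ x y c A B C → (x :- c :* y) :* (x :- c :* y) :+ (A :- (c :* B :+ c :* B) :+ c :* c :* C)
                         := (x :* x :+ A) :- (c :* (x :* y :+ B) :+ c :* (x :* y :+ B)) :+ c :* c :* (y :* y :+ C))
    refl x y c ‖ u ‖² ⟨ u , v ⟩ ‖ v ‖²)

‖shift‖²-expand : ∀ {m} (a δ : ℚ) (v x t : Vecℚ m) →
  ‖ (((a + δ) ·v v) +v x) -v t ‖² ≡
  ‖ ((a ·v v) +v x) -v t ‖² + (δ * ⟨ ((a ·v v) +v x) -v t , v ⟩ + δ * ⟨ ((a ·v v) +v x) -v t , v ⟩) + δ * δ * ⟨ v , v ⟩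
‖shift‖²-expand a δ [] [] [] = solve 1 (λ δ → con 0ℚ := con 0ℚ :+ (δ :* con 0ℚ :+ δ :* con 0ℚ) :+ δ :* δ :* con 0ℚ) refl δ
‖shift‖²-expand a δ (y ∷ v) (c ∷ x) (s ∷ t) =
  trans (cong (_+_ (((a + δ) * y + c - s) * ((a + δ) * y + c - s))) (‖shift‖²-expand a δ v x t))
  (solve 8 (λ a δ y c s E H V →
      ((a :+ δ) :* y :+ c :- s) :* ((a :+ δ) :* y :+ c :- s) :+ (E :+ (δ :* H :+ δ :* H) :+ δ :* δ :* V)
   := ((a :* y :+ c :- s) :* (a :* y :+ c :- s) :+ E) :+ (δ :* ((a :* y :+ c :- s) :* y :+ H) :+ δ :* ((a :* y :+ c :- s) :* y :+ H))
      :+ δ :* δ :* (y :* y :+ V))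
    refl a δ y c s ‖ ((a ·v v) +v x) -v t ‖² ⟨ ((a ·v v) +v x) -v t , v ⟩ ‖ v ‖²)

combℚ-0 : ∀ {m n} (B : Basis m n) → combℚ 0v B ≡ 0v
combℚ-0 [] = refl
combℚ-0 (b ∷ B) = trans (cong₂ _+v_ (·v-zeroˡ b) (combℚ-0 B)) (+v-identityˡ 0v)

combℚ-+ : ∀ {m n} (x y : Vec ℚ n) (B : Basis m n) → combℚ (x +v y) B ≡ combℚ x B +v combℚ y B
combℚ-+ [] [] [] = sym (+v-identityʳ 0v)
combℚ-+ (a ∷ x) (b ∷ y) (u ∷ B) =
  trans (cong (((a + b) ·v u) +v_) (combℚ-+ x y B)) (·v-+v-interchange a b u (combℚ x B) (combℚ y B))

combℚ-· : ∀ {m n} (c : ℚ) (x : Vec ℚ n) (B : Basis m n) → combℚ (c ·v x) B ≡ c ·v combℚ x B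
combℚ-· c [] [] = sym (·v-zeroʳ c)
combℚ-· c (a ∷ x) (u ∷ B) =
  trans (cong (((c * a) ·v u) +v_) (combℚ-· c x B)) (·v-distrib-step c a u (combℚ x B))

combℚ-assoc : ∀ {m k n} (z : Vec ℚ n) (M : Basis k n) (B : Basis m k) →
  combℚ (combℚ z M) B ≡ combℚ z (map (λ c → combℚ c B) M)
combℚ-assoc [] [] B = combℚ-0 B
combℚ-assoc (a ∷ z) (c ∷ M) B = trans (combℚ-+ (a ·v c) (combℚ z M) B)
  (cong₂ _+v_ (combℚ-· a c B) (combℚ-assoc z M B))

-- Projection orthogonal to v:  π u = u - (⟨u,v⟩ r)·v, where r plays the role of
-- 1/⟨v,v⟩.  Linearity holds for every r; the facts that π kills v and that
-- ‖u‖² = ‖π u‖² + ⟨u,v⟩²/⟨v,v⟩ need ⟨v,v⟩ r = 1.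
module Projection {m : ℕ} (v : Vecℚ m) (r : ℚ) where

  π : Vecℚ m → Vecℚ m
  π u = u -v ((⟨ u , v ⟩ * r) ·v v)

  π-+ : ∀ u w → π (u +v w) ≡ π u +v π w
  π-+ u w = trans
    (cong (λ k → (u +v w) -v (k ·v v)) (trans (cong (_* r) (⟨⟩-+ˡ u w v)) (*-distribʳ-+ r ⟨ u , v ⟩ ⟨ w , v ⟩)))
    (-v-·v-+ (⟨ u , v ⟩ * r) (⟨ w , v ⟩ * r) u w v)

  π-- : ∀ u w → π (u -v w) ≡ π u -v π w
  π-- u w = trans
    (cong (λ k → (u -v w) -v (k ·v v))
      (trans (cong (_* r) (⟨⟩--ˡ u w v)) (solve 3 (λ a b r → (a :- b) :* r := a :* r :- b :* r) refl ⟨ u , v ⟩ ⟨ w , v ⟩ r)))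
    (-v-·v-- (⟨ u , v ⟩ * r) (⟨ w , v ⟩ * r) u w v)

  π-· : ∀ c u → π (c ·v u) ≡ c ·v π u
  π-· c u = trans
    (cong (λ k → (c ·v u) -v (k ·v v)) (trans (cong (_* r) (⟨⟩-·ˡ c u v)) (*-assoc c ⟨ u , v ⟩ r)))
    (-v-·v-· c (⟨ u , v ⟩ * r) u v)

  π-0 : π 0v ≡ 0v
  π-0 = trans (cong (λ k → 0v -v (k ·v v)) (trans (cong (_* r) (⟨⟩-0ˡ v)) (*-zeroˡ r))) (-v-·v-zero v)

  π-combℚ : ∀ {n} (x : Vec ℚ n) (B : Basis m n) → π (combℚ x B) ≡ combℚ x (map π B)
  π-combℚ [] [] = π-0
  π-combℚ (a ∷ x) (b ∷ B) = trans (π-+ (a ·v b) (combℚ x B)) (cong₂ _+v_ (π-· a b) (π-combℚ x B))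

  module _ (vvr≡1 : ⟨ v , v ⟩ * r ≡ 1ℚ) where

    π-v : π v ≡ 0v
    π-v = trans (cong (λ k → v -v (k ·v v)) vvr≡1) (-v-·v-self v)

    π-lattice : ∀ {n} (a : ℤ) (as : Vec ℤ n) (B : Basis m n) →
      π ((ιℤ a ·v v) +v comb as B) ≡ comb as (map π B)
    π-lattice a as B = begin
      π ((ιℤ a ·v v) +v comb as B)         ≡⟨ π-+ (ιℤ a ·v v) (comb as B) ⟩
      π (ιℤ a ·v v) +v π (comb as B)       ≡⟨ cong₂ _+v_ (π-· (ιℤ a) v) (π-combℚ (map ιℤ as) B) ⟩
      (ιℤ a ·v π v) +v comb as (map π B)   ≡⟨ cong (λ w → (ιℤ a ·v w) +v comb as (map π B)) π-v ⟩
      (ιℤ a ·v 0v) +v comb as (map π B)    ≡⟨ cong (_+v comb as (map π B)) (·v-zeroʳ (ιℤ a)) ⟩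
      0v +v comb as (map π B)              ≡⟨ +v-identityˡ _ ⟩
      comb as (map π B)                    ∎
      where open ≡-Reasoning

    pythagoras : ∀ u → ‖ u ‖² ≡ ‖ π u ‖² + (⟨ u , v ⟩ * ⟨ u , v ⟩) * r
    pythagoras u = sym (begin
      ‖ π u ‖² + (H * H) * r
        ≡⟨ cong (_+ (H * H) * r) (‖-·‖²-expand (H * r) u v) ⟩
      N - ((H * r) * H + (H * r) * H) + (H * r) * (H * r) * V + (H * H) * r
        ≡⟨ solve 4 (λ N H r V → N :- ((H :* r) :* H :+ (H :* r) :* H) :+ (H :* r) :* (H :* r) :* V :+ (H :* H) :* r
                                 := N :+ ((H :* H) :* r) :* (V :* r) :- (H :* H) :* r) refl N H r V ⟩
      N + ((H * H) * r) * (V * r) - (H * H) * r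
        ≡⟨ cong (λ k → N + ((H * H) * r) * k - (H * H) * r) vvr≡1 ⟩
      N + ((H * H) * r) * 1ℚ - (H * H) * r
        ≡⟨ solve 3 (λ N H r → N :+ ((H :* H) :* r) :* con 1ℚ :- (H :* H) :* r := N) refl N H r ⟩
      N ∎)
      where
      open ≡-Reasoning
      H = ⟨ u , v ⟩
      N = ‖ u ‖²
      V = ⟨ v , v ⟩

    π-contracts : 0ℚ ≤ r → ∀ u → ‖ π u ‖² ≤ ‖ u ‖²
    π-contracts 0≤r u = subst (‖ π u ‖² ≤_) (sym (pythagoras u))
      (subst (_≤ ‖ π u ‖² + (⟨ u , v ⟩ * ⟨ u , v ⟩) * r) (+-identityʳ _)
        (+-monoʳ-≤ ‖ π u ‖² (0≤p*q (0≤p*p ⟨ u , v ⟩) 0≤r)))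

proj⊥≡π : ∀ {m} (v u : Vecℚ m) (vv≢0 : ⟨ v , v ⟩ ≢ 0ℚ) →
  proj⊥ v u ≡ Projection.π v ((1/ ⟨ v , v ⟩) {{≢-nonZero vv≢0}}) u
proj⊥≡π v u vv≢0 with ⟨ v , v ⟩ ≟ 0ℚ
... | yes vv≡0 = ⊥-elim (vv≢0 vv≡0)
... | no _ = refl

four : ℚ
four = + 4 / 1

BestCoefficient : ∀ {m} (v x t : Vecℚ m) → ℤ → Set
BestCoefficient v x t a = (a' : ℤ) → ‖ ((ιℤ a ·v v) +v x) -v t ‖² ≤ ‖ ((ιℤ a' ·v v) +v x) -v t ‖²

-- Rounding the coefficient of v: if a minimises ‖(a·v + x) - t‖² over ℤ, then the
-- error e = (a·v + x) - t satisfies |⟨e,v⟩| ≤ ‖v‖²/2, i.e. 4⟨e,v⟩²/‖v‖² ≤ ‖v‖².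
-- (Compare a with a + 1 and a - 1 and multiply the two resulting inequalities.)
nearest-coefficient : ∀ {m} (v x t : Vecℚ m) (a : ℤ) (r : ℚ) → ⟨ v , v ⟩ * r ≡ 1ℚ → 0ℚ ≤ r →
  BestCoefficient v x t a →
  four * ((⟨ ((ιℤ a ·v v) +v x) -v t , v ⟩ * ⟨ ((ιℤ a ·v v) +v x) -v t , v ⟩) * r) ≤ ⟨ v , v ⟩
nearest-coefficient v x t a r vvr≡1 0≤r a-nearest =
  0≤q-p⇒p≤q (subst (0ℚ ≤_) product≡ (0≤p*q (0≤p*q (shifted (+ 1) 1ℚ refl) (shifted -[1+ 0 ] (- 1ℚ) refl)) 0≤r))
  where
  open ≡-Reasoning
  e = ((ιℤ a ·v v) +v x) -v t
  h = ⟨ e , v ⟩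
  V = ⟨ v , v ⟩
  shifted : ∀ d δ → ιℤ d ≡ δ → 0ℚ ≤ (δ * h + δ * h) + δ * δ * V
  shifted d δ ιd≡δ = subst (0ℚ ≤_) (solve 3 (λ E X Y → E :+ X :+ Y :- E := X :+ Y) refl ‖ e ‖² _ _)
    (0≤q-p (subst (‖ e ‖² ≤_) shift-expansion (a-nearest (a Z.+ d))))
    where
    shift-expansion : ‖ ((ιℤ (a Z.+ d) ·v v) +v x) -v t ‖² ≡ ‖ e ‖² + (δ * h + δ * h) + δ * δ * V
    shift-expansion = trans (cong (λ q → ‖ ((q ·v v) +v x) -v t ‖²) (trans (ιℤ-+ a d) (cong (_+_ (ιℤ a)) ιd≡δ)))
      (‖shift‖²-expand (ιℤ a) δ v x t)
  product≡ : (((1ℚ * h + 1ℚ * h) + 1ℚ * 1ℚ * V) * (((- 1ℚ) * h + (- 1ℚ) * h) + (- 1ℚ) * (- 1ℚ) * V)) * r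
             ≡ V - four * ((h * h) * r)
  product≡ = begin
    _ ≡⟨ solve 3 (λ h V r → (((con 1ℚ :* h :+ con 1ℚ :* h) :+ con 1ℚ :* con 1ℚ :* V)
                             :* ((:- con 1ℚ :* h :+ :- con 1ℚ :* h) :+ (:- con 1ℚ) :* (:- con 1ℚ) :* V)) :* r
                          := V :* (V :* r) :- (con 1ℚ :+ con 1ℚ :+ con 1ℚ :+ con 1ℚ) :* ((h :* h) :* r)) refl h V r ⟩
    V * (V * r) - four * ((h * h) * r) ≡⟨ cong (λ k → V * k - four * ((h * h) * r)) vvr≡1 ⟩
    V * 1ℚ - four * ((h * h) * r)      ≡⟨ cong (_- four * ((h * h) * r)) (*-identityʳ V) ⟩
    V - four * ((h * h) * r)           ∎

Dependency : ∀ {m k} → Basis m k → Set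
Dependency {k = k} C = Σ (Vec ℚ k) λ z → z ≢ replicate k 0ℚ × combℚ z C ≡ 0v

combℚ-insertAt : ∀ {m k} (z : Vec ℚ k) (p : Fin (suc k)) (α : ℚ) (C : Basis m (suc k)) →
  combℚ (insertAt z p α) C ≡ (α ·v lookup C p) +v combℚ z (removeAt C p)
combℚ-insertAt z zero α (c ∷ C) = refl
combℚ-insertAt (a ∷ z) (suc p) α (c ∷ c' ∷ C) =
  trans (cong ((a ·v c) +v_) (combℚ-insertAt z p α (c' ∷ C)))
        (+v-swapˡ (a ·v c) (α ·v lookup (c' ∷ C) p) (combℚ z (removeAt (c' ∷ C) p)))

combℚ-removeAt : ∀ {m k} (x : Vec ℚ (suc k)) (p : Fin (suc k)) (W : Basis m (suc k)) →
  combℚ x W ≡ (lookup x p ·v lookup W p) +v combℚ (removeAt x p) (removeAt W p)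
combℚ-removeAt x p W = trans (cong (λ q → combℚ q W) (sym (VP.insertAt-removeAt x p)))
  (combℚ-insertAt (removeAt x p) p (lookup x p) W)

removeAt-replicate : ∀ {k} (p : Fin (suc k)) → removeAt (replicate (suc k) 0ℚ) p ≡ replicate k 0ℚ
removeAt-replicate zero = refl
removeAt-replicate {suc k} (suc p) = cong (0ℚ ∷_) (removeAt-replicate p)

insertAt-nonzero : ∀ {k} (z : Vec ℚ k) p α → z ≢ replicate k 0ℚ → insertAt z p α ≢ replicate (suc k) 0ℚ
insertAt-nonzero z p α z≢0 z'≡0 = z≢0 (begin
  z                                         ≡⟨ sym (VP.removeAt-insertAt z p α) ⟩
  removeAt (insertAt z p α) p               ≡⟨ cong (λ w → removeAt w p) z'≡0 ⟩
  removeAt (replicate _ 0ℚ) p               ≡⟨ removeAt-replicate p ⟩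
  replicate _ 0ℚ                            ∎)
  where open ≡-Reasoning

nonzero-entry : ∀ {k} (y : Vec ℚ k) → y ≢ replicate k 0ℚ → Σ (Fin k) λ p → lookup y p ≢ 0ℚ
nonzero-entry [] []≢0 = ⊥-elim ([]≢0 refl)
nonzero-entry (a ∷ y) ay≢0 with a ≟ 0ℚ
... | no a≢0 = zero , a≢0
... | yes refl with nonzero-entry y (λ y≡0 → ay≢0 (cong (0ℚ ∷_) y≡0))
... | p , yp≢0 = suc p , yp≢0

combℚ-head-tail : ∀ {j k} (z : Vec ℚ k) (X : Basis (suc j) k) →
  combℚ z X ≡ ⟨ z , map head X ⟩ ∷ combℚ z (map tail X)
combℚ-head-tail [] [] = refl
combℚ-head-tail (a ∷ z) ((h ∷ c) ∷ X) = cong ((a ·v (h ∷ c)) +v_) (combℚ-head-tail z X)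

relation-from-tails : ∀ {j k} (z : Vec ℚ k) (X : Basis (suc j) k) →
  map head X ≡ replicate k 0ℚ → combℚ z (map tail X) ≡ 0v → combℚ z X ≡ 0v
relation-from-tails z X heads≡0 tails≡0 =
  trans (combℚ-head-tail z X) (cong₂ _∷_ (trans (cong ⟨ z ,_⟩ heads≡0) (⟨⟩-0ʳ z)) tails≡0)

combℚ-subtract : ∀ {m k} (f : Vecℚ m → ℚ) (w : Vecℚ m) (z : Vec ℚ k) (X : Basis m k) →
  combℚ z (map (λ c → c -v (f c ·v w)) X) ≡ combℚ z X -v (⟨ z , map f X ⟩ ·v w)
combℚ-subtract f w [] [] = sym (-v-·v-zero w)
combℚ-subtract f w (a ∷ z) (c ∷ X) = trans (cong ((a ·v (c -v (f c ·v w))) +v_) (combℚ-subtract f w z X))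
  (·v-+v-collect a (f c) ⟨ z , map f X ⟩ c (combℚ z X) w)

pivot-factor : ∀ {j} (pivot : Vecℚ (suc j)) → head pivot ≢ 0ℚ → Vecℚ (suc j) → ℚ
pivot-factor pivot a≢0 c = head c * (1/ head pivot) {{≢-nonZero a≢0}}

clear : ∀ {j} (pivot : Vecℚ (suc j)) → head pivot ≢ 0ℚ → Vecℚ (suc j) → Vecℚ (suc j)
clear pivot a≢0 c = c -v (pivot-factor pivot a≢0 c ·v pivot)

cleared-heads : ∀ {j k} (pivot : Vecℚ (suc j)) (a≢0 : head pivot ≢ 0ℚ) (U : Basis (suc j) k) →
  map head (map (clear pivot a≢0) U) ≡ replicate k 0ℚ
cleared-heads pivot a≢0 [] = refl
cleared-heads (a ∷ pivot) a≢0 ((h ∷ c) ∷ U) = cong₂ _∷_ head≡0 (cleared-heads (a ∷ pivot) a≢0 U)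
  where
  instance _ = ≢-nonZero a≢0
  head≡0 : h - (h * 1/ a) * a ≡ 0ℚ
  head≡0 = trans (solve 3 (λ h a i → h :- (h :* i) :* a := h :- h :* (a :* i)) refl h a (1/ a))
    (trans (cong (λ k → h - h * k) (*-inverseʳ a)) (solve 1 (λ h → h :- h :* con 1ℚ := con 0ℚ) refl h))

-- A relation among the cleared remaining columns lifts to a relation among all columns,
-- the pivot column receiving the coefficient that undoes the clearing.
relation-by-pivot : ∀ {j k} (C : Basis (suc j) (suc k)) (p : Fin (suc k)) (a≢0 : head (lookup C p) ≢ 0ℚ) →
  Dependency (map tail (map (clear (lookup C p) a≢0) (removeAt C p))) → Dependency C
relation-by-pivot {j} C p a≢0 (z , z≢0 , tails≡0) = insertAt z p α , insertAt-nonzero z p α z≢0 , relation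
  where
  pivot = lookup C p
  f : Vecℚ (suc j) → ℚ
  f = pivot-factor pivot a≢0
  U = removeAt C p
  α : ℚ
  α = - ⟨ z , map f U ⟩
  relation : combℚ (insertAt z p α) C ≡ 0v
  relation = begin
    combℚ (insertAt z p α) C                       ≡⟨ combℚ-insertAt z p α C ⟩
    (α ·v pivot) +v combℚ z U                      ≡⟨ neg-·v-+v ⟨ z , map f U ⟩ pivot (combℚ z U) ⟩
    combℚ z U -v (⟨ z , map f U ⟩ ·v pivot)         ≡⟨ sym (combℚ-subtract f pivot z U) ⟩
    combℚ z (map (clear pivot a≢0) U)              ≡⟨ relation-from-tails z _ (cleared-heads pivot a≢0 U) tails≡0 ⟩
    0v                                             ∎
    where open ≡-Reasoning

-- More vectors than coordinates are linearly dependent: k vectors in ℚʲ with j < k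
-- satisfy a nontrivial rational relation (induction on j, eliminating the first coordinate).
dependent : ∀ j {k} → j N.< k → (C : Basis j k) → Dependency C
dependent zero {suc k} _ C = e₁ , (λ e₁≡0 → 1≢0 (cong head e₁≡0)) , no-coordinates (combℚ e₁ C)
  where
  e₁ : Vec ℚ (suc k)
  e₁ = 1ℚ ∷ replicate k 0ℚ
  no-coordinates : (x : Vec ℚ 0) → x ≡ 0v
  no-coordinates [] = refl
dependent (suc j) {suc k} (s≤s j<k) C with VP.≡-dec _≟_ (map head C) (replicate (suc k) 0ℚ)
... | yes heads≡0 with dependent j (NP.m<n⇒m<1+n j<k) (map tail C)
...   | z , z≢0 , tails≡0 = z , z≢0 , relation-from-tails z C heads≡0 tails≡0
dependent (suc j) {suc k} (s≤s j<k) C | no heads≢0 with nonzero-entry (map head C) heads≢0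
... | p , head≢0 = relation-by-pivot C p a≢0 (dependent j j<k _)
  where
  a≢0 : head (lookup C p) ≢ 0ℚ
  a≢0 a≡0 = head≢0 (trans (VP.lookup-map p head C) a≡0)

InSpan : ∀ {m k} → Basis m k → Vecℚ m → Set
InSpan {k = k} U u = Σ (Vec ℚ k) λ c → u ≡ combℚ c U

coefficient-matrix : ∀ {m k j} (U : Basis m k) (B : Basis m j) → All (InSpan U) B →
  Σ (Basis k j) λ M → B ≡ map (λ c → combℚ c U) M
coefficient-matrix U [] [] = [] , refl
coefficient-matrix U (b ∷ B) ((c , b≡Uc) ∷ rest) with coefficient-matrix U B rest
... | M , B≡UM = (c ∷ M) , cong₂ _∷_ b≡Uc B≡UM

dependent-in-span : ∀ {m k} (U : Basis m k) (B : Basis m (suc k)) → All (InSpan U) B → Dependency B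
dependent-in-span {k = k} U B B⊆U with coefficient-matrix U B B⊆U
... | M , B≡UM with dependent k (NP.n<1+n k) M
... | z , z≢0 , Mz≡0 = z , z≢0 , (begin
  combℚ z B                               ≡⟨ cong (combℚ z) B≡UM ⟩
  combℚ z (map (λ c → combℚ c U) M)       ≡⟨ sym (combℚ-assoc z M U) ⟩
  combℚ (combℚ z M) U                     ≡⟨ cong (λ q → combℚ q U) Mz≡0 ⟩
  combℚ 0v U                              ≡⟨ combℚ-0 U ⟩
  0v                                      ∎)
  where open ≡-Reasoning

redundant-column : ∀ {m k} (W : Basis m (suc k)) (y : Vec ℚ (suc k)) (p : Fin (suc k)) →
  combℚ y W ≡ 0v → lookup y p ≢ 0ℚ → ∀ x → InSpan (removeAt W p) (combℚ x W)
redundant-column {k = k} W y p Wy≡0 yp≢0 x = coefficients , (begin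
  combℚ x W                                         ≡⟨ combℚ-removeAt x p W ⟩
  (xp ·v lookup W p) +v combℚ (removeAt x p) U        ≡⟨ cong (λ w → (xp ·v w) +v combℚ (removeAt x p) U) Wp≡ ⟩
  (xp ·v ((- c) ·v Y)) +v combℚ (removeAt x p) U     ≡⟨ cong (_+v combℚ (removeAt x p) U) (sym (·v-assoc xp (- c) Y)) ⟩
  ((xp * - c) ·v Y) +v combℚ (removeAt x p) U        ≡⟨ cong (_+v combℚ (removeAt x p) U) (sym (combℚ-· (xp * - c) y' U)) ⟩
  combℚ ((xp * - c) ·v y') U +v combℚ (removeAt x p) U ≡⟨ sym (combℚ-+ ((xp * - c) ·v y') (removeAt x p) U) ⟩
  combℚ coefficients U                              ∎)
  where
  open ≡-Reasoning
  instance _ = ≢-nonZero yp≢0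
  c = 1/ lookup y p
  U = removeAt W p
  y' = removeAt y p
  Y = combℚ y' U
  xp = lookup x p
  coefficients : Vec ℚ k
  coefficients = ((xp * - c) ·v y') +v removeAt x p
  Wp≡ : lookup W p ≡ (- c) ·v Y
  Wp≡ = solve-for (lookup y p) c (lookup W p) Y (trans (sym (combℚ-removeAt y p W)) Wy≡0) (*-inverseʳ (lookup y p))

columns-in-lattice : ∀ {m k} (B : Basis m k) → All (InL B) B
columns-in-lattice [] = []
columns-in-lattice {k = suc k} (b ∷ B) = first ∷ All.map later (columns-in-lattice B)
  where
  first : InL (b ∷ B) b
  first = (+ 1 ∷ replicate k (+ 0)) , sym (trans
    (cong₂ _+v_ (·v-identityˡ b) (trans (cong (λ x → combℚ x B) (VP.map-replicate ιℤ (+ 0) k)) (combℚ-0 B)))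
    (+v-identityʳ b))
  later : ∀ {u} → InL B u → InL (b ∷ B) u
  later (x , u≡Bx) = (+ 0 ∷ x) , trans u≡Bx (sym (trans (cong (_+v comb x B) (·v-zeroˡ b)) (+v-identityˡ _)))

-- A basis generating the same lattice as a linearly independent basis of the same size
-- is linearly independent: otherwise all of B would lie in the span of k columns of W.
same-lattice-independent : ∀ {m k} (B W : Basis m (suc k)) → LinIndep B → SameLattice W B → LinIndep W
same-lattice-independent B W B-indep same y Wy≡0 with VP.≡-dec _≟_ y (replicate _ 0ℚ)
... | yes y≡0 = y≡0
... | no y≢0 with nonzero-entry y y≢0
... | p , yp≢0 with dependent-in-span (removeAt W p) B (All.map B⊆span (columns-in-lattice B))
  where
  B⊆span : ∀ {u} → InL B u → InSpan (removeAt W p) u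
  B⊆span u∈B with Equivalence.from (same _) u∈B
  ... | x , u≡Wx = let (c , Wx≡) = redundant-column W y p Wy≡0 yp≢0 (map ιℤ x) in c , trans u≡Wx Wx≡
... | z , z≢0 , Bz≡0 = ⊥-elim (z≢0 (B-indep z Bz≡0))

projection-independent : ∀ {m n} (v : Vecℚ m) (r : ℚ) (bs : Basis m n) →
  LinIndep (v ∷ bs) → LinIndep (map (Projection.π v r) bs)
projection-independent v r bs indep x πbs-x≡0 = cong tail (indep ((- β) ∷ x) relation)
  where
  β = ⟨ combℚ x bs , v ⟩ * r
  relation : ((- β) ·v v) +v combℚ x bs ≡ 0v
  relation = trans (neg-·v-+v β v (combℚ x bs)) (trans (Projection.π-combℚ v r x bs) πbs-x≡0)

Choice : ∀ {m} (x y z t : Vecℚ m) → Set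
Choice x y z t = (z ≡ x × ‖ x -v t ‖² ≤ ‖ y -v t ‖²) ⊎ (z ≡ y × ‖ y -v t ‖² ≤ ‖ x -v t ‖²)

chosen-has : ∀ {m} {x y z t : Vecℚ m} → Choice x y z t → (P : Vecℚ m → Set) → P x → P y → P z
chosen-has (inj₁ (refl , _)) P Px Py = Px
chosen-has (inj₂ (refl , _)) P Px Py = Py

chosen-closer : ∀ {m} {x y z t : Vecℚ m} → Choice x y z t →
  ‖ z -v t ‖² ≤ ‖ x -v t ‖² × ‖ z -v t ‖² ≤ ‖ y -v t ‖²
chosen-closer (inj₁ (refl , x≤y)) = ≤-refl , x≤y
chosen-closer (inj₂ (refl , y≤x)) = y≤x , ≤-refl

module Correctness (g : ℚ) (1<g : 1ℚ < g) (O : Oracle) (S : Subroutine)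
  (oracle : OracleSpec g O) (subroutine : SubroutineSpec g S) where

  Approximate : ∀ {m n} → Basis m (suc n) → Vecℚ m → Vecℚ m → Set
  Approximate {m} {n} B t z =
    InL B z × ((w : Vecℚ m) → InL B w → ‖ z -v t ‖² ≤ ((g * g) * (+ (suc n) / 1)) * ‖ w -v t ‖²)

  1≤g² : 1ℚ ≤ g * g
  1≤g² = 1≤p*q (<⇒≤ 1<g) (<⇒≤ 1<g)

  instance
    g-positive : Positive g
    g-positive = positive (<-trans (positive⁻¹ 1ℚ) 1<g)

  -- Rank one: rounding the coefficient of b₁ is exact, so the factor g² is not even needed.
  base-correct : ∀ {m} (b₁ t : Vecℚ m) (a : ℤ) →
    ((a' : ℤ) → ‖ (ιℤ a ·v b₁) -v t ‖² ≤ ‖ (ιℤ a' ·v b₁) -v t ‖²) →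
    Approximate (b₁ ∷ []) t (ιℤ a ·v b₁)
  base-correct b₁ t a a-nearest = ((a ∷ []) , sym (+v-identityʳ _)) , within
    where
    within : (w : Vecℚ _) → InL (b₁ ∷ []) w → ‖ (ιℤ a ·v b₁) -v t ‖² ≤ ((g * g) * (+ 1 / 1)) * ‖ w -v t ‖²
    within _ ((x ∷ []) , refl) = ≤-trans
      (subst (λ q → ‖ (ιℤ a ·v b₁) -v t ‖² ≤ ‖ q -v t ‖²) (sym (+v-identityʳ (ιℤ x ·v b₁))) (a-nearest x))
      (p≤k*p (subst (1ℚ ≤_) (sym (*-identityʳ (g * g))) 1≤g²) (‖‖²-nonNeg (((ιℤ x ·v b₁) +v 0v) -v t)))

  module Step {m n} (B : Basis m (suc (suc n))) (B-indep : LinIndep B) where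

    v : Vecℚ m
    v = O B

    v≢0 : ⟨ v , v ⟩ ≢ 0ℚ
    v≢0 vv≡0 = proj₁ (proj₂ (oracle B B-indep)) (‖‖²≡0⇒≡0 v vv≡0)

    instance _ = ≢-nonZero v≢0

    r : ℚ
    r = 1/ ⟨ v , v ⟩

    vvr≡1 : ⟨ v , v ⟩ * r ≡ 1ℚ
    vvr≡1 = *-inverseʳ ⟨ v , v ⟩

    0≤r : 0ℚ ≤ r
    0≤r = subst (0ℚ ≤_)
      (trans (solve 2 (λ V r → V :* (r :* r) := (V :* r) :* r) refl ⟨ v , v ⟩ r)
        (trans (cong (_* r) vvr≡1) (*-identityˡ r)))
      (0≤p*q (‖‖²-nonNeg v) (0≤p*p r))

    open Projection v r

    proj⊥-basis : ∀ {k} (bs : Basis m k) → map (proj⊥ v) bs ≡ map π bs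
    proj⊥-basis = VP.map-cong (λ u → proj⊥≡π v u v≢0)

    projected-independent : (bs : Basis m (suc n)) → SameLattice (v ∷ bs) B → LinIndep (map (proj⊥ v) bs)
    projected-independent bs same = subst LinIndep (sym (proj⊥-basis bs))
      (projection-independent v r bs (same-lattice-independent B (v ∷ bs) B-indep same))

    -- Far target: if ‖v‖² > g·4g·‖w - t‖² then every nonzero lattice vector u has
    -- 4g‖w - t‖² ≤ ‖u‖² (as ‖v‖² ≤ g‖u‖²), so S returns a closest vector.
    far-target : ∀ t w → InL B w → ¬ (⟨ v , v ⟩ ≤ g * ((four * g) * ‖ w -v t ‖²)) →
      ‖ S B t -v t ‖² ≤ ‖ w -v t ‖²
    far-target t w w∈L far = proj₂ closest w w∈L
      where
      separated : (u : Vecℚ m) → InL B u → u ≢ 0v → (four * g) * ‖ w -v t ‖² ≤ ‖ u ‖²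
      separated u u∈L u≢0 with (four * g) * ‖ w -v t ‖² ≤? ‖ u ‖²
      ... | yes ok = ok
      ... | no short = ⊥-elim (far (≤-trans (proj₂ (proj₂ (oracle B B-indep)) u u∈L u≢0)
                                           (<⇒≤ (*-monoʳ-<-pos g (≰⇒> short)))))
      closest : Closest B t (S B t)
      closest = proj₂ (subroutine B t B-indep) (w , w∈L , separated)

    -- Near target: the error e = z₂ - t of the lifted recursive answer splits into its
    -- projection, bounded by the recursive guarantee, and its component along v, bounded
    -- by rounding a₁; by Pythagoras ‖e‖² ≤ g²(n+1)·d² + g²·d² with d = ‖w - t‖.
    near-target : (t : Vecℚ m) (bs : Basis m (suc n)) → SameLattice (v ∷ bs) B →
      (z₂' : Vecℚ m) → Approximate (map (proj⊥ v) bs) (proj⊥ v t) z₂' →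
      (as : Vec ℤ (suc n)) → z₂' ≡ comb as (map (proj⊥ v) bs) →
      (a₁ : ℤ) → BestCoefficient v (comb as bs) t a₁ →
      (w : Vecℚ m) → InL B w → ⟨ v , v ⟩ ≤ g * ((four * g) * ‖ w -v t ‖²) →
      ‖ ((ιℤ a₁ ·v v) +v comb as bs) -v t ‖² ≤ ((g * g) * (+ (suc (suc n)) / 1)) * ‖ w -v t ‖²
    near-target t bs same z₂' recursive as z₂'≡ a₁ a₁-nearest w w∈L near =
      subst₂ _≤_ (sym (pythagoras vvr≡1 e)) total (+-mono-≤ projected-error along-v-error)
      where
      e = ((ιℤ a₁ ·v v) +v comb as bs) -v t
      h = ⟨ e , v ⟩
      d² = ‖ w -v t ‖²
      G : ℚ
      G = (g * g) * (+ (suc n) / 1)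
      0≤G : 0ℚ ≤ G
      0≤G = 0≤p*q (0≤p*p g) (0≤ιℤ (suc n))
      π-bs : map (proj⊥ v) bs ≡ map π bs
      π-bs = proj⊥-basis bs
      π-recursive : Approximate (map π bs) (π t) z₂'
      π-recursive = subst₂ (λ B' t' → Approximate B' t' z₂') π-bs (proj⊥≡π v t v≢0) recursive
      πw∈L : InL (map π bs) (π w)
      πw∈L with Equivalence.from (same w) w∈L
      ... | (k ∷ ks) , w≡ = ks , trans (cong π w≡) (π-lattice vvr≡1 k ks bs)
      πe≡ : π e ≡ z₂' -v π t
      πe≡ = trans (π-- _ t) (cong (_-v π t)
        (trans (π-lattice vvr≡1 a₁ as bs) (sym (trans z₂'≡ (cong (comb as) π-bs)))))
      projected-error : ‖ π e ‖² ≤ G * d²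
      projected-error = begin
        ‖ π e ‖²               ≡⟨ cong ‖_‖² πe≡ ⟩
        ‖ z₂' -v π t ‖²        ≤⟨ proj₂ π-recursive (π w) πw∈L ⟩
        G * ‖ π w -v π t ‖²    ≡⟨ cong (λ q → G * ‖ q ‖²) (sym (π-- w t)) ⟩
        G * ‖ π (w -v t) ‖²    ≤⟨ *-monoˡ-≤-nonNeg G {{nonNegative 0≤G}} (π-contracts vvr≡1 0≤r (w -v t)) ⟩
        G * d²                 ∎
        where open ≤-Reasoning
      along-v-error : (h * h) * r ≤ (g * g) * d²
      along-v-error = *-cancelˡ-≤-pos four (begin
        four * ((h * h) * r)       ≤⟨ nearest-coefficient v (comb as bs) t a₁ r vvr≡1 0≤r a₁-nearest ⟩
        ⟨ v , v ⟩                  ≤⟨ near ⟩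
        g * ((four * g) * d²)      ≡⟨ solve 3 (λ g f d → g :* ((f :* g) :* d) := f :* ((g :* g) :* d)) refl g four d² ⟩
        four * ((g * g) * d²)      ∎)
        where open ≤-Reasoning
      total : G * d² + (g * g) * d² ≡ ((g * g) * (+ (suc (suc n)) / 1)) * d²
      total = trans
        (solve 3 (λ g i d → (g :* g :* i) :* d :+ (g :* g) :* d := (g :* g :* (con 1ℚ :+ i)) :* d) refl g (+ (suc n) / 1) d²)
        (cong (λ q → ((g * g) * q) * d²) (sym (ιℤ-suc (suc n))))

  -- A recursive step is correct provided the recursive call was: split on whether the
  -- target is far (S is exact) or near (the lifted recursive answer is good enough).
  step-correct : ∀ {m n} (B : Basis m (suc (suc n))) (t : Vecℚ m) → LinIndep B →
    (bs : Basis m (suc n)) → SameLattice (O B ∷ bs) B →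
    (z₂' : Vecℚ m) → Approximate (map (proj⊥ (O B)) bs) (proj⊥ (O B) t) z₂' →
    (as : Vec ℤ (suc n)) → z₂' ≡ comb as (map (proj⊥ (O B)) bs) →
    (a₁ : ℤ) → BestCoefficient (O B) (comb as bs) t a₁ →
    (z : Vecℚ m) →
    Choice (S B t) ((ιℤ a₁ ·v O B) +v comb as bs) z t →
    Approximate B t z
  step-correct {m} {n} B t B-indep bs same z₂' recursive as z₂'≡ a₁ a₁-nearest z choice = z∈L , within
    where
    open Step B B-indep
    z₂ : Vecℚ m
    z₂ = (ιℤ a₁ ·v v) +v comb as bs
    K : ℚ
    K = (g * g) * (+ (suc (suc n)) / 1)
    z∈L : InL B z
    z∈L = chosen-has choice (InL B) (proj₁ (subroutine B t B-indep))
                                   (Equivalence.to (same z₂) ((a₁ ∷ as) , refl))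
    within : (w : Vecℚ m) → InL B w → ‖ z -v t ‖² ≤ K * ‖ w -v t ‖²
    within w w∈L with ⟨ v , v ⟩ ≤? g * ((four * g) * ‖ w -v t ‖²)
    ... | yes near = ≤-trans (proj₂ (chosen-closer choice))
                             (near-target t bs same z₂' recursive as z₂'≡ a₁ a₁-nearest w w∈L near)
    ... | no far = ≤-trans (proj₁ (chosen-closer choice))
                   (≤-trans (far-target t w w∈L far) (p≤k*p (1≤p*q 1≤g² (1≤ιℤ (suc n))) (‖‖²-nonNeg (w -v t))))

-- Induction on the derivation of the output; each recursive call runs on an
-- independent basis, so the induction hypothesis applies to it.
theorem3 : (g : ℚ) → 1ℚ < g → (O : Oracle) → (S : Subroutine) →
    OracleSpec g O → SubroutineSpec g S →
    ∀ {m n} (B : Basis m (suc n)) (t : Vecℚ m) (z : Vecℚ m) →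
    LinIndep B → CVP O S B t z →
    InL B z × ((w : Vecℚ m) → InL B w →
      ‖ z -v t ‖² ≤ ((g * g) * (+ (suc n) / 1)) * ‖ w -v t ‖²)
theorem3 g 1<g O S oracle subroutine _ _ _ _ (base b₁ t a a-nearest) = base-correct b₁ t a a-nearest
  where open Correctness g 1<g O S oracle subroutine
theorem3 g 1<g O S oracle subroutine B t z B-indep (step _ _ bs same z₂' call as z₂'≡ a₁ a₁-nearest _ choice) =
  step-correct B t B-indep bs same z₂' recursive as z₂'≡ a₁ a₁-nearest z choice
  where
  open Correctness g 1<g O S oracle subroutine
  recursive : Approximate (map (proj⊥ (O B)) bs) (proj⊥ (O B) t) z₂'
  recursive = theorem3 g 1<g O S oracle subroutine _ _ z₂' (Step.projected-independent B B-indep bs same) call
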